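{- Let $\omega=e^{2\pi i/3}$, $\mathcal{E}=\mathbb{Z}[\omega]$ (Eisenstein integers), $\theta=\omega-\bar\omega$, and regard $\mathcal{E}^4$-modules in $\mathbb{C}^4$ as real $8$-dimensional lattices with inner product $\mathrm{Re}\sum u_i\bar v_i$. For each of the following six quadruples of vectors in $\mathbb{C}^4$, let $\Lambda$ be the $\mathcal{E}$-module they span: (1) $(\theta,0,0,0),(0,\theta,0,0),(0,0,\theta,0),(0,0,0,\theta)$; (2) $(0,1,-1,1),(1,0,-1,-1),(1,-1,0,1),(1,1,1,0)$; (3) $(0,1,-1,\omega),(1,0,-\omega,-\bar\omega),(1,-\omega,0,\bar\omega),(1,\omega,\omega,0)$; (4) $(0,1,-\omega,\omega),(1,0,-\omega,-\omega),(1,-1,0,\omega),(1,1,\omega,0)$; (5) $(0,1,-\omega,\bar\omega),(1,0,-\bar\omega,-1),(1,-\omega,0,1),(1,\omega,\bar\omega,0)$; (6) $(0,1,-\omega,1),(1,0,-1,-\bar\omega),(1,-\bar\omega,0,\bar\omega),(1,\bar\omega,1,0)$; and for each of the quadruples (3)–(6) also let $\Lambda$ be the $\mathcal{E}$-module spanned by the complex conjugates of its four vectors. This gives ten lattices $\Lambda_1,\dots,\Lambda_{10}$, each similar to $A_2^4$. Then $\Lambda_1\cap\cdots\cap\Lambda_{10}$ is the $\mathcal{E}$-module spanned by $\theta$ times the rows of $$\begin{bmatrix}\theta&0&0&0\\0&\theta&0&0\\1&1&1&0\\0&1&-1&1\end{bmatrix},$$ which is a copy of the root lattice $E_8$. Moreover,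 the intersection of the lattices from quadruples (1) and (2) alone is also this same lattice.
   Context: $A_2$ is the planar hexagonal lattice; $\mathcal{E}$ regarded as a real 2-dimensional lattice is similar to $A_2$. -}

module Defs where

open import Data.Integer using (ℤ; +_; -_; _+_; _-_; _*_; 0ℤ; 1ℤ)
open import Data.Integer.Divisibility using (_∣_)
open import Data.Nat using (ℕ; suc)
open import Data.Fin using (Fin; zero; suc)
open import Data.Vec using (Vec; []; _∷_; foldr; zipWith; map; replicate; lookup)
open import Data.Vec.Relation.Unary.All using (All)
open import Data.Product using (Σ; _×_; _,_)
open import Data.Sum using (_⊎_)
open import Relation.Binary.PropositionalEquality using (_≡_)

-- Eisenstein integers  a + b ω  (ω = e^{2πi/3}, ω² = -1 - ω)

record 𝓔 : Set where
  constructor mkE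
  field
    re : ℤ
    om : ℤ
open 𝓔 public

infixl 6 _⊕_
infixl 7 _⊗_

_⊕_ : 𝓔 → 𝓔 → 𝓔
(mkE a b) ⊕ (mkE c d) = mkE (a + c) (b + d)

_⊗_ : 𝓔 → 𝓔 → 𝓔
(mkE a b) ⊗ (mkE c d) = mkE (a * c - b * d) (a * d + b * c - b * d)

⊖_ : 𝓔 → 𝓔
⊖ (mkE a b) = mkE (- a) (- b)

-- complex conjugation: conj(ω) = ω̄ = -1 - ω
conj : 𝓔 → 𝓔
conj (mkE a b) = mkE (a - b) (- b)

e0 e1 ω ω̄ θ : 𝓔
e0 = mkE 0ℤ 0ℤ
e1 = mkE 1ℤ 0ℤ
ω  = mkE 0ℤ 1ℤ
ω̄  = conj ω
θ  = ω ⊕ (⊖ ω̄)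

-- twice the real part of u * conj v:
-- 2 Re((a+bω)(c+dω̄)) = 2ac + 2bd - ad - bc
re2 : 𝓔 → 𝓔 → ℤ
re2 (mkE a b) (mkE c d) = (+ 2) * (a * c) + (+ 2) * (b * d) - a * d - b * c

𝓔⁴ : Set
𝓔⁴ = Vec 𝓔 4

_⊕⁴_ : 𝓔⁴ → 𝓔⁴ → 𝓔⁴
_⊕⁴_ = zipWith _⊕_

_·⁴_ : 𝓔 → 𝓔⁴ → 𝓔⁴
c ·⁴ v = map (c ⊗_) v

conj⁴ : 𝓔⁴ → 𝓔⁴
conj⁴ = map conj

sumℤ : ∀ {n} → Vec ℤ n → ℤ
sumℤ = foldr _ _+_ 0ℤ

-- twice the real inner product Re Σ u_i conj(v_i)
form𝓔⁴ : 𝓔⁴ → 𝓔⁴ → ℤ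
form𝓔⁴ u v = sumℤ (zipWith re2 u v)

InSpan : Vec 𝓔⁴ 4 → 𝓔⁴ → Set
InSpan gens v = Σ (Vec 𝓔 4) λ cs →
  v ≡ foldr _ _⊕⁴_ (replicate 4 e0) (zipWith _·⁴_ cs gens)

record QSpace : Set₁ where
  field
    Carrier : Set
    _+ᵥ_    : Carrier → Carrier → Carrier
    form    : Carrier → Carrier → ℤ   -- a positive multiple of the inner product
open QSpace public

Similar : (S : QSpace) → (Carrier S → Set) → (T : QSpace) → (Carrier T → Set) → Set
Similar S L T M =
  Σ (Carrier S → Carrier T) λ f →
    (∀ x → L x → M (f x)) ×
    (∀ y → M y → Σ (Carrier S) λ x → L x × f x ≡ y) ×
    (∀ x y → L x → L y → f x ≡ f y → x ≡ y) ×
    (∀ x y → L x → L y → f (_+ᵥ_ S x y) ≡ _+ᵥ_ T (f x) (f y)) ×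
    Σ ℕ λ p → Σ ℕ λ q →
      (∀ x y → L x → L y →
         (+ suc p) * form T (f x) (f y) ≡ (+ suc q) * form S x y)

𝓔⁴-space : QSpace
𝓔⁴-space = record { Carrier = 𝓔⁴ ; _+ᵥ_ = _⊕⁴_ ; form = form𝓔⁴ }

dot : ∀ {n} → Vec ℤ n → Vec ℤ n → ℤ
dot u v = sumℤ (zipWith _*_ u v)

A2⁴-space : QSpace
A2⁴-space = record
  { Carrier = Vec (Vec ℤ 3) 4
  ; _+ᵥ_ = zipWith (zipWith _+_)
  ; form = λ u v → sumℤ (zipWith dot u v) }

A2⁴ : Vec (Vec ℤ 3) 4 → Set
A2⁴ x = All (λ t → sumℤ t ≡ 0ℤ) x

-- E₈ in doubled coordinates: y = 2x with x ∈ ℤ⁸ ∪ (ℤ+½)⁸, Σ x even;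
-- i.e. y all even or all odd, and 4 ∣ Σ y.  Form = dot product (4× standard).
ℤ⁸-space : QSpace
ℤ⁸-space = record { Carrier = Vec ℤ 8 ; _+ᵥ_ = zipWith _+_ ; form = dot }

E8 : Vec ℤ 8 → Set
E8 y = (All (λ t → (+ 2) ∣ t) y ⊎ All (λ t → (+ 2) ∣ (t + 1ℤ)) y) × ((+ 4) ∣ sumℤ y)

v4 : 𝓔 → 𝓔 → 𝓔 → 𝓔 → 𝓔⁴
v4 a b c d = a ∷ b ∷ c ∷ d ∷ []

m1 : 𝓔
m1 = ⊖ e1

gens : Fin 6 → Vec 𝓔⁴ 4
gens zero = v4 θ e0 e0 e0 ∷ v4 e0 θ e0 e0 ∷ v4 e0 e0 θ e0 ∷ v4 e0 e0 e0 θ ∷ []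
gens (suc zero) =
  v4 e0 e1 m1 e1 ∷ v4 e1 e0 m1 m1 ∷ v4 e1 m1 e0 e1 ∷ v4 e1 e1 e1 e0 ∷ []
gens (suc (suc zero)) =
  v4 e0 e1 m1 ω ∷ v4 e1 e0 (⊖ ω) (⊖ ω̄) ∷ v4 e1 (⊖ ω) e0 ω̄ ∷ v4 e1 ω ω e0 ∷ []
gens (suc (suc (suc zero))) =
  v4 e0 e1 (⊖ ω) ω ∷ v4 e1 e0 (⊖ ω) (⊖ ω) ∷ v4 e1 m1 e0 ω ∷ v4 e1 e1 ω e0 ∷ []
gens (suc (suc (suc (suc zero)))) =
  v4 e0 e1 (⊖ ω) ω̄ ∷ v4 e1 e0 (⊖ ω̄) m1 ∷ v4 e1 (⊖ ω) e0 e1 ∷ v4 e1 ω ω̄ e0 ∷ []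
gens (suc (suc (suc (suc (suc zero))))) =
  v4 e0 e1 (⊖ ω) e1 ∷ v4 e1 e0 m1 (⊖ ω̄) ∷ v4 e1 (⊖ ω̄) e0 ω̄ ∷ v4 e1 ω̄ e1 e0 ∷ []

Λ : Fin 10 → 𝓔⁴ → Set
Λ zero = InSpan (gens zero)
Λ (suc zero) = InSpan (gens (suc zero))
Λ (suc (suc zero)) = InSpan (gens (suc (suc zero)))
Λ (suc (suc (suc zero))) = InSpan (gens (suc (suc (suc zero))))
Λ (suc (suc (suc (suc zero)))) = InSpan (gens (suc (suc (suc (suc zero)))))
Λ (suc (suc (suc (suc (suc zero))))) = InSpan (gens (suc (suc (suc (suc (suc zero))))))
Λ (suc (suc (suc (suc (suc (suc zero)))))) = InSpan (map conj⁴ (gens (suc (suc zero))))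
Λ (suc (suc (suc (suc (suc (suc (suc zero))))))) = InSpan (map conj⁴ (gens (suc (suc (suc zero)))))
Λ (suc (suc (suc (suc (suc (suc (suc (suc zero)))))))) = InSpan (map conj⁴ (gens (suc (suc (suc (suc zero))))))
Λ (suc (suc (suc (suc (suc (suc (suc (suc (suc zero))))))))) = InSpan (map conj⁴ (gens (suc (suc (suc (suc (suc zero)))))))

E8gens : Vec 𝓔⁴ 4
E8gens = map (θ ·⁴_)
  (v4 θ e0 e0 e0 ∷ v4 e0 θ e0 e0 ∷ v4 e1 e1 e1 e0 ∷ v4 e0 e1 m1 e1 ∷ [])

Λ∩ : 𝓔⁴ → Set
Λ∩ = InSpan E8gens

-- Each of the ten generating quadruples Γ is an orthogonal frame for the Hermitian form
-- h(u, v) = Σ uᵢ v̄ᵢ with h(g, g) = 3, so v ↦ (h(v, g)/3)_{g ∈ Γ} maps the span of Γ onto 𝓔⁴,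
-- and 𝓔 with the form 2 Re(x ȳ) is A₂ via a + bω ↦ (a, b − a, −b); hence every Λᵢ is similar
-- to A₂⁴.  The E₈ generators M admit a quadruple D with pair(Mᵢ, Dⱼ) = 3 δᵢⱼ for the bilinear
-- pairing Σ uᵢ vᵢ.  On Λ₂ the pairings with D₁ and D₂ are visibly divisible by 3, on Λ₁ those
-- with D₃ and D₄, which gives the coefficients of any v ∈ Λ₁ ∩ Λ₂ in M; conversely every
-- generator in M has integral frame coordinates in every Λᵢ.  Finally an explicit ℤ-linear map
-- sends the D-coordinates onto the doubled E₈ = {b·𝟙 + 2x | Σ x even}, multiplying the form
-- by 4/9.

module Submission where

open import Defs hiding (dot; re2; sumℤ)
open import Data.Nat as ℕ using (ℕ; zero; suc; s≤s)
import Data.Nat.DivMod as ℕ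
import Data.Nat.Properties as ℕ
open import Data.Fin using (Fin; zero; suc; #_; combine)
open import Data.Integer as ℤ using (ℤ; +_; -[1+_]; 0ℤ; 1ℤ)
import Data.Integer.DivMod as ℤ
import Data.Integer.Properties as ℤ
import Data.Integer.Divisibility as ℤᵘ
import Data.Integer.Divisibility.Signed as ℤˢ
open import Data.Integer.Solver using (module +-*-Solver)
open +-*-Solver
  using (Polynomial; con; var; _:+_; _:*_; :-_; _:-_; _:=_; ⟦_⟧; ⟦_⟧N; Normal; normalise; prove; solve)
open import Data.Product using (Σ; ∃-syntax; _×_; _,_; proj₁; proj₂)
open import Data.Sum using (_⊎_; inj₁; inj₂)
open import Data.Vec
  using (Vec; []; _∷_; map; tabulate; concat; zipWith; foldr; replicate; lookup; last; take; drop; _++_)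
open import Data.Vec.Properties using (∷-injective; map-∘; map-cong; map-id; zipWith-replicate)
open import Data.Vec.Relation.Unary.All as All using (All; []; _∷_; universal)
open import Data.Vec.Relation.Unary.All.Properties using (map⁺; lookup⁺)
open import Function using (id; _∘_)
open import Function.Bundles using (_⇔_; mk⇔)
open import Level using (0ℓ)
open import Algebra.Bundles.Raw using (RawRing)
open import Relation.Binary.PropositionalEquality
open import Algebra.Definitions {A = 𝓔} _≡_
open ≡-Reasoning

-- The explicit formulas, written once over raw rings: at (𝓔, ℤ) they are the functions of the
-- development, at (Ex n, Zx n) they build polynomial syntax evaluating definitionally to the
-- same expressions, so that identities between them can be decided by normalisation.
module Formulas
  (Eᴿ Zᴿ : RawRing 0ℓ 0ℓ)
  (mk : RawRing.Carrier Zᴿ → RawRing.Carrier Zᴿ → RawRing.Carrier Eᴿ)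
  (re om : RawRing.Carrier Eᴿ → RawRing.Carrier Zᴿ)
  (fromℤ : ℤ → RawRing.Carrier Zᴿ)
  where

  open RawRing Eᴿ using () renaming (Carrier to E; _+_ to _+ᴱ_; _*_ to _*ᴱ_; -_ to -ᴱ_; 0# to 0ᴱ)
  open RawRing Zᴿ using (_+_; _*_; -_) renaming (Carrier to Z)

  infixl 6 _-_ _-ᴱ_
  _-_ : Z → Z → Z
  x - y = x + - y

  _-ᴱ_ : E → E → E
  x -ᴱ y = x +ᴱ -ᴱ y

  0ᵥ : ∀ {n} → Vec E n
  0ᵥ = replicate _ 0ᴱ

  infixl 6 _⊕ᵥ_ _⊖ᵥ_
  infixr 7 _·ᵥ_
  _⊕ᵥ_ _⊖ᵥ_ : ∀ {n} → Vec E n → Vec E n → Vec E n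
  _⊕ᵥ_ = zipWith _+ᴱ_
  _⊖ᵥ_ = zipWith _-ᴱ_

  _·ᵥ_ : ∀ {n} → E → Vec E n → Vec E n
  c ·ᵥ v = map (c *ᴱ_) v

  lincomb : ∀ {m n} → Vec E m → Vec (Vec E n) m → Vec E n
  lincomb cs gs = foldr _ _⊕ᵥ_ 0ᵥ (zipWith _·ᵥ_ cs gs)

  pair : ∀ {n} → Vec E n → Vec E n → E
  pair u v = foldr _ _+ᴱ_ 0ᴱ (zipWith _*ᴱ_ u v)

  scale : ℤ → E → E
  scale k x = mk (fromℤ k * re x) (fromℤ k * om x)

  -- twice the real part
  tr : E → Z
  tr x = fromℤ (+ 2) * re x - om x

  -- at (𝓔, ℤ) these coincide with sumℤ, dot, re2 and (for n = 4) form𝓔⁴ of Defs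
  sum : ∀ {n} → Vec Z n → Z
  sum = foldr _ _+_ (fromℤ 0ℤ)

  dot : ∀ {n} → Vec Z n → Vec Z n → Z
  dot u v = sum (zipWith _*_ u v)

  re2 : E → E → Z
  re2 x y = fromℤ (+ 2) * (re x * re y) + fromℤ (+ 2) * (om x * om y) - re x * om y - om x * re y

  formⁿ : ∀ {n} → Vec E n → Vec E n → Z
  formⁿ u v = sum (zipWith re2 u v)

  φ : E → Vec Z 3
  φ x = re x ∷ om x - re x ∷ - om x ∷ []

  -- For v = lincomb cs (gens 1) = lincomb ds (gens 0) these are the pairings of v with
  -- E8duals divided by 3, each computed from the representation where 3 visibly divides it.
  intersection-coefficients : Vec E 4 → Vec E 4 → Vec E 4
  intersection-coefficients (_ ∷ c₂ ∷ c₃ ∷ _ ∷ []) (_ ∷ _ ∷ d₃ ∷ d₄ ∷ []) =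
    -ᴱ c₂ ∷ c₃ -ᴱ c₂ ∷ d₃ +ᴱ d₄ ∷ d₄ ∷ []

  defect : Vec E 4 → Vec E 4
  defect (δ₁ ∷ δ₂ ∷ δ₃ ∷ δ₄ ∷ []) = δ₁ -ᴱ δ₃ -ᴱ δ₄ ∷ δ₂ -ᴱ δ₃ -ᴱ δ₄ -ᴱ δ₄ ∷ 0ᴱ ∷ 0ᴱ ∷ []

  E8-half : Vec E 4 → Vec Z 8
  E8-half (e₁ ∷ e₂ ∷ e₃ ∷ e₄ ∷ []) =
    re e₁ - om e₁ ∷ re e₁ ∷ om e₁ - re e₃ ∷ re e₂ - om e₂ + re e₄ ∷
    re e₂ - re e₄ + om e₄ ∷ om e₂ - re e₃ ∷ - om e₄ ∷ fromℤ 0ℤ ∷ []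

  toE8 : Vec E 4 → Vec Z 8
  toE8 es@(_ ∷ _ ∷ e₃ ∷ _ ∷ []) = map (λ t → om e₃ + fromℤ (+ 2) * t) (E8-half es)

  quadrupled-coordinates : Vec Z 8 → Vec E 4
  quadrupled-coordinates (y₁ ∷ y₂ ∷ y₃ ∷ y₄ ∷ y₅ ∷ y₆ ∷ y₇ ∷ y₈ ∷ []) =
    mk (fromℤ (+ 2) * (y₂ - y₈)) (fromℤ (+ 2) * (y₂ - y₁)) ∷
    mk (y₄ + y₅ + y₆ + y₂ - y₁ - y₃ - fromℤ (+ 3) * y₈ + y₇) (fromℤ (+ 2) * (y₆ + y₂ - y₁ - y₃)) ∷
    mk (fromℤ (+ 2) * (y₂ - y₁ - y₃ + y₈)) (fromℤ (+ 4) * y₈) ∷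
    mk (y₄ - y₅ + y₆ + y₂ - y₁ - y₃ + y₈ - y₇) (fromℤ (+ 2) * (y₈ - y₇)) ∷ []

  E8-shifted : Z → Vec Z 7 → Vec Z 8
  E8-shifted b (q₁ ∷ q₂ ∷ q₃ ∷ q₄ ∷ q₅ ∷ q₆ ∷ q₇ ∷ []) =
    b + fromℤ (+ 2) * q₁ ∷ b + fromℤ (+ 2) * q₂ ∷ b + fromℤ (+ 2) * q₃ ∷ b + fromℤ (+ 2) * q₄ ∷
    b + fromℤ (+ 2) * q₅ ∷ b + fromℤ (+ 2) * q₆ ∷ b + fromℤ (+ 2) * q₇ ∷ b ∷ []

  -- E8-param b (q₁, q₂, q₃, q₄, q₆, q₇, Q) is the vector of E₈ with last entry b, entries
  -- b + 2qᵢ and entry sum 4Q; fifth solves the sum condition for the missing q₅.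
  fifth : Z → Vec Z 7 → Z
  fifth b (q₁ ∷ q₂ ∷ q₃ ∷ q₄ ∷ q₆ ∷ q₇ ∷ Q ∷ []) =
    fromℤ (+ 2) * Q - fromℤ (+ 4) * b - (q₁ + q₂ + q₃ + q₄ + q₆ + q₇)

  E8-param : Z → Vec Z 7 → Vec Z 8
  E8-param b ps@(q₁ ∷ q₂ ∷ q₃ ∷ q₄ ∷ q₆ ∷ q₇ ∷ _ ∷ []) =
    E8-shifted b (q₁ ∷ q₂ ∷ q₃ ∷ q₄ ∷ fifth b ps ∷ q₆ ∷ q₇ ∷ [])

  E8-preimage : Z → Vec Z 7 → Vec E 4
  E8-preimage b (q₁ ∷ q₂ ∷ q₃ ∷ q₄ ∷ q₆ ∷ q₇ ∷ Q ∷ []) =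
    mk q₂ (q₂ - q₁) ∷ mk a₂ b₂ ∷ mk a₃ b ∷ mk (q₄ + b₂ - a₂) (- q₇) ∷ []
    where
    a₃ = q₂ - q₁ - q₃
    b₂ = q₆ + a₃
    a₂ = Q - fromℤ (+ 2) * b - q₁ - q₃

open import Data.Integer using (_+_; _*_; -_; _-_)

-- Symbolic evaluation

-- a record rather than Polynomial n itself, so that n is inferable from the type
record Zx (n : ℕ) : Set where
  constructor ⌜_⌝
  field ⌞_⌟ : Polynomial n
open Zx

Ex : ℕ → Set
Ex n = Zx n × Zx n

module _ {n : ℕ} where
  infixl 6 _+ᶻ_ _-ᶻ_
  infixl 7 _*ᶻ_
  infix 8 -ᶻ_
  _+ᶻ_ _*ᶻ_ _-ᶻ_ : Zx n → Zx n → Zx n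
  ⌜ p ⌝ +ᶻ ⌜ q ⌝ = ⌜ p :+ q ⌝
  ⌜ p ⌝ *ᶻ ⌜ q ⌝ = ⌜ p :* q ⌝
  ⌜ p ⌝ -ᶻ ⌜ q ⌝ = ⌜ p :- q ⌝

  -ᶻ_ : Zx n → Zx n
  -ᶻ ⌜ p ⌝ = ⌜ :- p ⌝

  conᶻ : ℤ → Zx n
  conᶻ c = ⌜ con c ⌝

  -- the defining equations of _⊕_, _⊗_, ⊖_ and conj: ⟦_⟧ˣ commutes with them by computation
  infixl 6 _⊕ˣ_
  infixl 7 _⊗ˣ_
  _⊕ˣ_ _⊗ˣ_ : Ex n → Ex n → Ex n
  (a , b) ⊕ˣ (c , d) = a +ᶻ c , b +ᶻ d
  (a , b) ⊗ˣ (c , d) = a *ᶻ c -ᶻ b *ᶻ d , a *ᶻ d +ᶻ b *ᶻ c -ᶻ b *ᶻ d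

  ⊖ˣ_ conjˣ : Ex n → Ex n
  ⊖ˣ (a , b) = -ᶻ a , -ᶻ b
  conjˣ (a , b) = a -ᶻ b , -ᶻ b

  liftˣ : 𝓔 → Ex n
  liftˣ x = conᶻ (re x) , conᶻ (om x)

  Zx-rawRing Ex-rawRing : RawRing 0ℓ 0ℓ
  Zx-rawRing = record
    { Carrier = Zx n ; _≈_ = _≡_ ; _+_ = _+ᶻ_ ; _*_ = _*ᶻ_ ; -_ = -ᶻ_ ; 0# = conᶻ 0ℤ ; 1# = conᶻ 1ℤ }
  Ex-rawRing = record
    { Carrier = Ex n ; _≈_ = _≡_ ; _+_ = _⊕ˣ_ ; _*_ = _⊗ˣ_ ; -_ = ⊖ˣ_ ; 0# = liftˣ e0 ; 1# = liftˣ e1 }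

  ⟦_⟧ᶻ : Zx n → Vec ℤ n → ℤ
  ⟦ ⌜ p ⌝ ⟧ᶻ ρ = ⟦ p ⟧ ρ

  ⟦_⟧ˣ : Ex n → Vec ℤ n → 𝓔
  ⟦ a , b ⟧ˣ ρ = mkE (⟦ a ⟧ᶻ ρ) (⟦ b ⟧ᶻ ρ)

  normalᶻ : Zx n → Normal n
  normalᶻ p = normalise ⌞ p ⌟

  normalˣ : Ex n → Normal n × Normal n
  normalˣ (a , b) = normalᶻ a , normalᶻ b

module Sym {n : ℕ} = Formulas (Ex-rawRing {n}) Zx-rawRing _,_ proj₁ proj₂ conᶻ

𝓔-rawRing : RawRing 0ℓ 0ℓ
𝓔-rawRing = record { Carrier = 𝓔 ; _≈_ = _≡_ ; _+_ = _⊕_ ; _*_ = _⊗_ ; -_ = ⊖_ ; 0# = e0 ; 1# = e1 }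

open Formulas 𝓔-rawRing ℤ.+-*-rawRing mkE re om id hiding (_-_; _-ᴱ_)

byNormalisationᶻ : ∀ {n} (p q : Zx n) → normalᶻ p ≡ normalᶻ q → ∀ ρ → ⟦ p ⟧ᶻ ρ ≡ ⟦ q ⟧ᶻ ρ
byNormalisationᶻ ⌜ p ⌝ ⌜ q ⌝ eq ρ = prove ρ p q (cong (λ r → ⟦ r ⟧N ρ) eq)

byNormalisationˣ : ∀ {n} (p q : Ex n) → normalˣ p ≡ normalˣ q → ∀ ρ → ⟦ p ⟧ˣ ρ ≡ ⟦ q ⟧ˣ ρ
byNormalisationˣ (a , b) (c , d) eq ρ =
  cong₂ mkE (byNormalisationᶻ a c (cong proj₁ eq) ρ) (byNormalisationᶻ b d (cong proj₂ eq) ρ)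

byNormalisationᶻᵥ : ∀ {n k} (ps qs : Vec (Zx n) k) → map normalᶻ ps ≡ map normalᶻ qs →
                    ∀ ρ → map (λ p → ⟦ p ⟧ᶻ ρ) ps ≡ map (λ p → ⟦ p ⟧ᶻ ρ) qs
byNormalisationᶻᵥ []       []       _  ρ = refl
byNormalisationᶻᵥ (p ∷ ps) (q ∷ qs) eq ρ = cong₂ _∷_
  (byNormalisationᶻ p q (proj₁ (∷-injective eq)) ρ) (byNormalisationᶻᵥ ps qs (proj₂ (∷-injective eq)) ρ)

byNormalisationˣᵥ : ∀ {n k} (ps qs : Vec (Ex n) k) → map normalˣ ps ≡ map normalˣ qs →
                    ∀ ρ → map (λ p → ⟦ p ⟧ˣ ρ) ps ≡ map (λ p → ⟦ p ⟧ˣ ρ) qs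
byNormalisationˣᵥ []       []       _  ρ = refl
byNormalisationˣᵥ (p ∷ ps) (q ∷ qs) eq ρ = cong₂ _∷_
  (byNormalisationˣ p q (proj₁ (∷-injective eq)) ρ) (byNormalisationˣᵥ ps qs (proj₂ (∷-injective eq)) ρ)

env : ∀ {k} → Vec 𝓔 k → Vec ℤ (k ℕ.* 2)
env xs = concat (map (λ x → re x ∷ om x ∷ []) xs)

variablesᶻ : ∀ n → Vec (Zx n) n
variablesᶻ n = tabulate λ i → ⌜ var i ⌝

variablesˣ : ∀ k → Vec (Ex (k ℕ.* 2)) k
variablesˣ k = tabulate λ i → ⌜ var (combine i zero) ⌝ , ⌜ var (combine i (suc zero)) ⌝

liftᵐ : ∀ {n m k} → Vec (Vec 𝓔 m) k → Vec (Vec (Ex n) m) k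
liftᵐ = map (map liftˣ)

𝕩 : ∀ {n} → Ex (2 ℕ.+ n)
𝕩 = ⌜ var (# 0) ⌝ , ⌜ var (# 1) ⌝
𝕪 : ∀ {n} → Ex (4 ℕ.+ n)
𝕪 = ⌜ var (# 2) ⌝ , ⌜ var (# 3) ⌝
𝕫 : ∀ {n} → Ex (6 ℕ.+ n)
𝕫 = ⌜ var (# 4) ⌝ , ⌜ var (# 5) ⌝
𝕨 : ∀ {n} → Ex (8 ℕ.+ n)
𝕨 = ⌜ var (# 6) ⌝ , ⌜ var (# 7) ⌝

⊕-interchange : Interchangable _⊕_ _⊕_
⊕-interchange w x y z =
  byNormalisationˣ ((𝕩 ⊕ˣ 𝕪) ⊕ˣ (𝕫 ⊕ˣ 𝕨)) ((𝕩 ⊕ˣ 𝕫) ⊕ˣ (𝕪 ⊕ˣ 𝕨)) refl (env (w ∷ x ∷ y ∷ z ∷ []))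

⊗-assoc : Associative _⊗_
⊗-assoc x y z = byNormalisationˣ ((𝕩 ⊗ˣ 𝕪) ⊗ˣ 𝕫) (𝕩 ⊗ˣ (𝕪 ⊗ˣ 𝕫)) refl (env (x ∷ y ∷ z ∷ []))

⊗-comm : Commutative _⊗_
⊗-comm x y = byNormalisationˣ (𝕩 ⊗ˣ 𝕪) (𝕪 ⊗ˣ 𝕩) refl (env (x ∷ y ∷ []))

⊗-distribˡ : _⊗_ DistributesOverˡ _⊕_
⊗-distribˡ x y z = byNormalisationˣ (𝕩 ⊗ˣ (𝕪 ⊕ˣ 𝕫)) (𝕩 ⊗ˣ 𝕪 ⊕ˣ 𝕩 ⊗ˣ 𝕫) refl (env (x ∷ y ∷ z ∷ []))

⊗-distribʳ : _⊗_ DistributesOverʳ _⊕_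
⊗-distribʳ x y z = byNormalisationˣ ((𝕪 ⊕ˣ 𝕫) ⊗ˣ 𝕩) (𝕪 ⊗ˣ 𝕩 ⊕ˣ 𝕫 ⊗ˣ 𝕩) refl (env (x ∷ y ∷ z ∷ []))

⊗-zeroˡ : LeftZero e0 _⊗_
⊗-zeroˡ x = byNormalisationˣ (liftˣ e0 ⊗ˣ 𝕩) (liftˣ e0) refl (env (x ∷ []))

⊗-zeroʳ : RightZero e0 _⊗_
⊗-zeroʳ x = byNormalisationˣ (𝕩 ⊗ˣ liftˣ e0) (liftˣ e0) refl (env (x ∷ []))

conj-⊕ : ∀ x y → conj (x ⊕ y) ≡ conj x ⊕ conj y
conj-⊕ x y = byNormalisationˣ (conjˣ (𝕩 ⊕ˣ 𝕪)) (conjˣ 𝕩 ⊕ˣ conjˣ 𝕪) refl (env (x ∷ y ∷ []))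

conj-⊗ : ∀ x y → conj (x ⊗ y) ≡ conj x ⊗ conj y
conj-⊗ x y = byNormalisationˣ (conjˣ (𝕩 ⊗ˣ 𝕪)) (conjˣ 𝕩 ⊗ˣ conjˣ 𝕪) refl (env (x ∷ y ∷ []))

conj-involutive : Involutive conj
conj-involutive x = byNormalisationˣ (conjˣ (conjˣ 𝕩)) 𝕩 refl (env (x ∷ []))

tr-⊕ : ∀ x y → tr (x ⊕ y) ≡ tr x + tr y
tr-⊕ x y = byNormalisationᶻ (Sym.tr (𝕩 ⊕ˣ 𝕪)) (Sym.tr 𝕩 +ᶻ Sym.tr 𝕪) refl (env (x ∷ y ∷ []))

re2≡tr : ∀ x y → re2 x y ≡ tr (x ⊗ conj y)
re2≡tr x y = byNormalisationᶻ (Sym.re2 𝕩 𝕪) (Sym.tr (𝕩 ⊗ˣ conjˣ 𝕪)) refl (env (x ∷ y ∷ []))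

three : 𝓔
three = mkE (+ 3) 0ℤ

three-⊗ : ∀ x → three ⊗ x ≡ scale (+ 3) x
three-⊗ x = byNormalisationˣ (liftˣ three ⊗ˣ 𝕩) (Sym.scale (+ 3) 𝕩) refl (env (x ∷ []))

tr-three : ∀ x → tr (three ⊗ x) ≡ + 3 * tr x
tr-three x = byNormalisationᶻ (Sym.tr (liftˣ three ⊗ˣ 𝕩)) (conᶻ (+ 3) *ᶻ Sym.tr 𝕩) refl (env (x ∷ []))

⊕ᵥ-interchange : ∀ {n} (w x y z : Vec 𝓔 n) → (w ⊕ᵥ x) ⊕ᵥ (y ⊕ᵥ z) ≡ (w ⊕ᵥ y) ⊕ᵥ (x ⊕ᵥ z)
⊕ᵥ-interchange []       []       []       []       = refl
⊕ᵥ-interchange (w ∷ ws) (x ∷ xs) (y ∷ ys) (z ∷ zs) =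
  cong₂ _∷_ (⊕-interchange w x y z) (⊕ᵥ-interchange ws xs ys zs)

0ᵥ⊕ᵥ0ᵥ : ∀ {n} → 0ᵥ {n} ⊕ᵥ 0ᵥ ≡ 0ᵥ
0ᵥ⊕ᵥ0ᵥ = zipWith-replicate _⊕_ e0 e0

·ᵥ-distribʳ : ∀ {n} c d (v : Vec 𝓔 n) → (c ⊕ d) ·ᵥ v ≡ c ·ᵥ v ⊕ᵥ d ·ᵥ v
·ᵥ-distribʳ c d []       = refl
·ᵥ-distribʳ c d (x ∷ xs) = cong₂ _∷_ (⊗-distribʳ x c d) (·ᵥ-distribʳ c d xs)

·ᵥ-distribˡ : ∀ {n} c (u v : Vec 𝓔 n) → c ·ᵥ (u ⊕ᵥ v) ≡ c ·ᵥ u ⊕ᵥ c ·ᵥ v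
·ᵥ-distribˡ c []       []       = refl
·ᵥ-distribˡ c (x ∷ xs) (y ∷ ys) = cong₂ _∷_ (⊗-distribˡ c x y) (·ᵥ-distribˡ c xs ys)

·ᵥ-assoc : ∀ {n} c d (v : Vec 𝓔 n) → c ·ᵥ d ·ᵥ v ≡ (c ⊗ d) ·ᵥ v
·ᵥ-assoc c d []       = refl
·ᵥ-assoc c d (x ∷ xs) = cong₂ _∷_ (sym (⊗-assoc c d x)) (·ᵥ-assoc c d xs)

·ᵥ-zeroˡ : ∀ {n} (v : Vec 𝓔 n) → e0 ·ᵥ v ≡ 0ᵥ
·ᵥ-zeroˡ []       = refl
·ᵥ-zeroˡ (x ∷ xs) = cong₂ _∷_ (⊗-zeroˡ x) (·ᵥ-zeroˡ xs)

·ᵥ-zeroʳ : ∀ {n} c → c ·ᵥ 0ᵥ {n} ≡ 0ᵥ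
·ᵥ-zeroʳ {zero}  c = refl
·ᵥ-zeroʳ {suc n} c = cong₂ _∷_ (⊗-zeroʳ c) (·ᵥ-zeroʳ c)

conj-·ᵥ : ∀ {n} c (v : Vec 𝓔 n) → map conj (c ·ᵥ v) ≡ conj c ·ᵥ map conj v
conj-·ᵥ c []       = refl
conj-·ᵥ c (x ∷ xs) = cong₂ _∷_ (conj-⊗ c x) (conj-·ᵥ c xs)

lincomb-⊕ : ∀ {m n} (cs ds : Vec 𝓔 m) (gs : Vec (Vec 𝓔 n) m) →
            lincomb (cs ⊕ᵥ ds) gs ≡ lincomb cs gs ⊕ᵥ lincomb ds gs
lincomb-⊕ []       []       []       = sym 0ᵥ⊕ᵥ0ᵥ
lincomb-⊕ (c ∷ cs) (d ∷ ds) (g ∷ gs) = begin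
  (c ⊕ d) ·ᵥ g ⊕ᵥ lincomb (cs ⊕ᵥ ds) gs
    ≡⟨ cong₂ _⊕ᵥ_ (·ᵥ-distribʳ c d g) (lincomb-⊕ cs ds gs) ⟩
  (c ·ᵥ g ⊕ᵥ d ·ᵥ g) ⊕ᵥ (lincomb cs gs ⊕ᵥ lincomb ds gs)
    ≡⟨ ⊕ᵥ-interchange (c ·ᵥ g) (d ·ᵥ g) (lincomb cs gs) (lincomb ds gs) ⟩
  (c ·ᵥ g ⊕ᵥ lincomb cs gs) ⊕ᵥ (d ·ᵥ g ⊕ᵥ lincomb ds gs) ∎

lincomb-· : ∀ {m n} c (cs : Vec 𝓔 m) (gs : Vec (Vec 𝓔 n) m) →
            lincomb (c ·ᵥ cs) gs ≡ c ·ᵥ lincomb cs gs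
lincomb-· c []       []       = sym (·ᵥ-zeroʳ c)
lincomb-· c (a ∷ cs) (g ∷ gs) = begin
  (c ⊗ a) ·ᵥ g ⊕ᵥ lincomb (c ·ᵥ cs) gs ≡⟨ cong₂ _⊕ᵥ_ (sym (·ᵥ-assoc c a g)) (lincomb-· c cs gs) ⟩
  c ·ᵥ a ·ᵥ g ⊕ᵥ c ·ᵥ lincomb cs gs    ≡⟨ sym (·ᵥ-distribˡ c _ _) ⟩
  c ·ᵥ (a ·ᵥ g ⊕ᵥ lincomb cs gs)       ∎

lincomb-0ᵥ : ∀ {m n} (gs : Vec (Vec 𝓔 n) m) → lincomb 0ᵥ gs ≡ 0ᵥ
lincomb-0ᵥ []       = refl
lincomb-0ᵥ (g ∷ gs) = trans (cong₂ _⊕ᵥ_ (·ᵥ-zeroˡ g) (lincomb-0ᵥ gs)) 0ᵥ⊕ᵥ0ᵥ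

pair-⊕ˡ : ∀ {n} (u v w : Vec 𝓔 n) → pair (u ⊕ᵥ v) w ≡ pair u w ⊕ pair v w
pair-⊕ˡ []       []       []       = refl
pair-⊕ˡ (x ∷ xs) (y ∷ ys) (z ∷ zs) = begin
  (x ⊕ y) ⊗ z ⊕ pair (xs ⊕ᵥ ys) zs
    ≡⟨ cong₂ _⊕_ (⊗-distribʳ z x y) (pair-⊕ˡ xs ys zs) ⟩
  (x ⊗ z ⊕ y ⊗ z) ⊕ (pair xs zs ⊕ pair ys zs)
    ≡⟨ ⊕-interchange (x ⊗ z) (y ⊗ z) (pair xs zs) (pair ys zs) ⟩
  (x ⊗ z ⊕ pair xs zs) ⊕ (y ⊗ z ⊕ pair ys zs) ∎

pair-·ˡ : ∀ {n} c (u v : Vec 𝓔 n) → pair (c ·ᵥ u) v ≡ c ⊗ pair u v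
pair-·ˡ c []       []       = sym (⊗-zeroʳ c)
pair-·ˡ c (x ∷ xs) (y ∷ ys) = begin
  c ⊗ x ⊗ y ⊕ pair (c ·ᵥ xs) ys   ≡⟨ cong₂ _⊕_ (⊗-assoc c x y) (pair-·ˡ c xs ys) ⟩
  c ⊗ (x ⊗ y) ⊕ c ⊗ pair xs ys   ≡⟨ sym (⊗-distribˡ c _ _) ⟩
  c ⊗ (x ⊗ y ⊕ pair xs ys)       ∎

pair-0ᵥˡ : ∀ {n} (v : Vec 𝓔 n) → pair 0ᵥ v ≡ e0
pair-0ᵥˡ []       = refl
pair-0ᵥˡ (x ∷ xs) = cong₂ _⊕_ (⊗-zeroˡ x) (pair-0ᵥˡ xs)

pair-comm : ∀ {n} (u v : Vec 𝓔 n) → pair u v ≡ pair v u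
pair-comm []       []       = refl
pair-comm (x ∷ xs) (y ∷ ys) = cong₂ _⊕_ (⊗-comm x y) (pair-comm xs ys)

pair-·ʳ : ∀ {n} c (u v : Vec 𝓔 n) → pair u (c ·ᵥ v) ≡ c ⊗ pair u v
pair-·ʳ c u v = trans (pair-comm u _) (trans (pair-·ˡ c v u) (cong (c ⊗_) (pair-comm v u)))

conj-pair : ∀ {n} (u v : Vec 𝓔 n) → conj (pair u v) ≡ pair (map conj u) (map conj v)
conj-pair []       []       = refl
conj-pair (x ∷ xs) (y ∷ ys) =
  trans (conj-⊕ (x ⊗ y) _) (cong₂ _⊕_ (conj-⊗ x y) (conj-pair xs ys))

pair-lincombˡ : ∀ {m n} (cs : Vec 𝓔 m) (gs : Vec (Vec 𝓔 n) m) w →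
                pair (lincomb cs gs) w ≡ pair cs (map (λ g → pair g w) gs)
pair-lincombˡ []       []       w = pair-0ᵥˡ w
pair-lincombˡ (c ∷ cs) (g ∷ gs) w = begin
  pair (c ·ᵥ g ⊕ᵥ lincomb cs gs) w         ≡⟨ pair-⊕ˡ (c ·ᵥ g) _ w ⟩
  pair (c ·ᵥ g) w ⊕ pair (lincomb cs gs) w ≡⟨ cong₂ _⊕_ (pair-·ˡ c g w) (pair-lincombˡ cs gs w) ⟩
  c ⊗ pair g w ⊕ pair cs (map (λ g → pair g w) gs) ∎

herm : ∀ {n} → Vec 𝓔 n → Vec 𝓔 n → 𝓔
herm u v = pair u (map conj v)

map-conj-involutive : ∀ {n} (v : Vec 𝓔 n) → map conj (map conj v) ≡ v
map-conj-involutive []       = refl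
map-conj-involutive (x ∷ xs) = cong₂ _∷_ (conj-involutive x) (map-conj-involutive xs)

herm-sym : ∀ {n} (u v : Vec 𝓔 n) → herm u v ≡ conj (herm v u)
herm-sym u v = sym (begin
  conj (pair v (map conj u))                  ≡⟨ conj-pair v _ ⟩
  pair (map conj v) (map conj (map conj u))   ≡⟨ cong (pair (map conj v)) (map-conj-involutive u) ⟩
  pair (map conj v) u                         ≡⟨ pair-comm _ u ⟩
  pair u (map conj v)                         ∎)

form-trace : ∀ {n} (u v : Vec 𝓔 n) → formⁿ u v ≡ tr (herm u v)
form-trace []       []       = refl
form-trace (x ∷ xs) (y ∷ ys) = begin
  re2 x y + formⁿ xs ys              ≡⟨ cong₂ _+_ (re2≡tr x y) (form-trace xs ys) ⟩
  tr (x ⊗ conj y) + tr (herm xs ys)  ≡⟨ sym (tr-⊕ (x ⊗ conj y) _) ⟩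
  tr (x ⊗ conj y ⊕ herm xs ys)        ∎

-- Coordinates with respect to a basis with a known dual

-- exact division; on non-multiples of d the value is junk
_÷_ : ℤ → (d : ℕ) → .{{ℕ.NonZero d}} → ℤ
(+ n)    ÷ d = + (n ℕ./ d)
-[1+ n ] ÷ d = - (+ (suc n ℕ./ d))

*-/ : ∀ d n → (suc d ℕ.* n) ℕ./ suc d ≡ n
*-/ d n = trans (cong (ℕ._/ suc d) (ℕ.*-comm (suc d) n)) (ℕ.m*n/n≡m n (suc d))

*-÷ : ∀ d z → (+ suc d * z) ÷ suc d ≡ z
*-÷ d (+ zero)  = cong (_÷ suc d) (ℤ.*-zeroʳ (+ suc d))
*-÷ d (+ suc n) = cong +_ (*-/ d (suc n))
*-÷ d -[1+ n ]  = cong (λ t → - (+ t)) (*-/ d (suc n))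

divide : (d : ℕ) → .{{ℕ.NonZero d}} → 𝓔 → 𝓔
divide d x = mkE (re x ÷ d) (om x ÷ d)

divide-scale : ∀ d x → divide (suc d) (scale (+ suc d) x) ≡ x
divide-scale d x = cong₂ mkE (*-÷ d (re x)) (*-÷ d (om x))

threeI : Vec 𝓔⁴ 4
threeI = v4 three e0 e0 e0 ∷ v4 e0 three e0 e0 ∷ v4 e0 e0 three e0 ∷ v4 e0 e0 e0 three ∷ []

pair-threeI : ∀ cs → map (pair cs) threeI ≡ three ·ᵥ cs
pair-threeI cs@(_ ∷ _ ∷ _ ∷ _ ∷ []) =
  byNormalisationˣᵥ (map (Sym.pair x) (liftᵐ threeI)) (liftˣ three Sym.·ᵥ x) refl (env cs)
  where x = variablesˣ 4

DualBases : Vec 𝓔⁴ 4 → Vec 𝓔⁴ 4 → Set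
DualBases M D = map (λ d → map (λ g → pair g d) M) D ≡ threeI

pair-dual : ∀ {M D} → DualBases M D → ∀ cs → map (pair (lincomb cs M)) D ≡ three ·ᵥ cs
pair-dual {M} {D} dual cs = begin
  map (pair (lincomb cs M)) D                           ≡⟨ map-cong (pair-lincombˡ cs M) D ⟩
  map (λ d → pair cs (map (λ g → pair g d) M)) D        ≡⟨ map-∘ (pair cs) _ D ⟩
  map (pair cs) (map (λ d → map (λ g → pair g d) M) D)  ≡⟨ cong (map (pair cs)) dual ⟩
  map (pair cs) threeI                                  ≡⟨ pair-threeI cs ⟩
  three ·ᵥ cs                                           ∎

coordinates : Vec 𝓔⁴ 4 → 𝓔⁴ → Vec 𝓔 4
coordinates D v = map (λ d → divide 3 (pair v d)) D

coordinates-lincomb : ∀ {M D} → DualBases M D → ∀ cs → coordinates D (lincomb cs M) ≡ cs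
coordinates-lincomb {M} {D} dual cs = begin
  map (divide 3 ∘ pair (lincomb cs M)) D        ≡⟨ map-∘ (divide 3) _ D ⟩
  map (divide 3) (map (pair (lincomb cs M)) D)  ≡⟨ cong (map (divide 3)) (pair-dual dual cs) ⟩
  map (divide 3) (three ·ᵥ cs)                  ≡⟨ sym (map-∘ (divide 3) (three ⊗_) cs) ⟩
  map (divide 3 ∘ (three ⊗_)) cs                ≡⟨ map-cong third cs ⟩
  map id cs                                     ≡⟨ map-id cs ⟩
  cs                                            ∎
  where
  third : ∀ c → divide 3 (three ⊗ c) ≡ c
  third c = trans (cong (divide 3) (three-⊗ c)) (divide-scale 2 c)

Reconstructs : ∀ {k} → Vec 𝓔⁴ 4 → (𝓔⁴ → Vec 𝓔 4) → Vec 𝓔⁴ k → Set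
Reconstructs M κ N = map (λ v → lincomb (κ v) M) N ≡ N

lincomb-∈-span : ∀ {k M} κ {N : Vec 𝓔⁴ k} → Reconstructs M κ N → ∀ es → InSpan M (lincomb es N)
lincomb-∈-span {M = M} κ {[]}    _  []       = 0ᵥ , sym (lincomb-0ᵥ M)
lincomb-∈-span {M = M} κ {w ∷ N} eq (e ∷ es) with lincomb-∈-span κ (proj₂ (∷-injective eq)) es
... | bs , rest≡ = e ·ᵥ κ w ⊕ᵥ bs , (begin
  e ·ᵥ w ⊕ᵥ lincomb es N
    ≡⟨ cong₂ (λ u v → e ·ᵥ u ⊕ᵥ v) (sym (proj₁ (∷-injective eq))) rest≡ ⟩
  e ·ᵥ lincomb (κ w) M ⊕ᵥ lincomb bs M      ≡⟨ cong (_⊕ᵥ lincomb bs M) (sym (lincomb-· e (κ w) M)) ⟩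
  lincomb (e ·ᵥ κ w) M ⊕ᵥ lincomb bs M      ≡⟨ sym (lincomb-⊕ (e ·ᵥ κ w) bs M) ⟩
  lincomb (e ·ᵥ κ w ⊕ᵥ bs) M                ∎)

span-⊆ : ∀ {M N} κ → Reconstructs M κ N → ∀ {v} → InSpan N v → InSpan M v
span-⊆ κ rec (es , refl) = lincomb-∈-span κ rec es

record CoordinateModel (M : Vec 𝓔⁴ 4) (T : QSpace) (P : Carrier T → Set) : Set where
  field
    embed         : Vec 𝓔 4 → Carrier T
    unembed       : Carrier T → Vec 𝓔 4
    unembed-embed : ∀ cs → unembed (embed cs) ≡ cs
    embed-⊕       : ∀ cs ds → embed (cs ⊕ᵥ ds) ≡ _+ᵥ_ T (embed cs) (embed ds)
    embed-into    : ∀ cs → P (embed cs)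
    embed-onto    : ∀ y → P y → ∃[ cs ] embed cs ≡ y
    p q           : ℕ
    embed-form    : ∀ cs ds → + suc p * form T (embed cs) (embed ds)
                              ≡ + suc q * form𝓔⁴ (lincomb cs M) (lincomb ds M)

span-similar : ∀ {M T P} D → DualBases M D → CoordinateModel M T P → Similar 𝓔⁴-space (InSpan M) T P
span-similar {M} {T} {P} D dual model =
  f , into , onto , injective , additive , p , q , scaling
  where
  open CoordinateModel model
  f : 𝓔⁴ → Carrier T
  f v = embed (coordinates D v)

  f-lincomb : ∀ cs → f (lincomb cs M) ≡ embed cs
  f-lincomb cs = cong embed (coordinates-lincomb dual cs)

  into : ∀ x → InSpan M x → P (f x)
  into _ (cs , refl) = subst P (sym (f-lincomb cs)) (embed-into cs)

  onto : ∀ y → P y → Σ 𝓔⁴ λ x → InSpan M x × f x ≡ y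
  onto y Py with embed-onto y Py
  ... | cs , refl = lincomb cs M , (cs , refl) , f-lincomb cs

  injective : ∀ x y → InSpan M x → InSpan M y → f x ≡ f y → x ≡ y
  injective _ _ (cs , refl) (ds , refl) eq = cong (λ c → lincomb c M) (begin
    cs                 ≡⟨ sym (unembed-embed cs) ⟩
    unembed (embed cs) ≡⟨ cong unembed (trans (sym (f-lincomb cs)) (trans eq (f-lincomb ds))) ⟩
    unembed (embed ds) ≡⟨ unembed-embed ds ⟩
    ds                 ∎)

  additive : ∀ x y → InSpan M x → InSpan M y → f (x ⊕⁴ y) ≡ _+ᵥ_ T (f x) (f y)
  additive _ _ (cs , refl) (ds , refl) = begin
    f (lincomb cs M ⊕ᵥ lincomb ds M)   ≡⟨ cong f (sym (lincomb-⊕ cs ds M)) ⟩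
    f (lincomb (cs ⊕ᵥ ds) M)           ≡⟨ f-lincomb (cs ⊕ᵥ ds) ⟩
    embed (cs ⊕ᵥ ds)                   ≡⟨ embed-⊕ cs ds ⟩
    _+ᵥ_ T (embed cs) (embed ds)       ≡⟨ sym (cong₂ (_+ᵥ_ T) (f-lincomb cs) (f-lincomb ds)) ⟩
    _+ᵥ_ T (f (lincomb cs M)) (f (lincomb ds M)) ∎

  scaling : ∀ x y → InSpan M x → InSpan M y → + suc p * form T (f x) (f y) ≡ + suc q * form𝓔⁴ x y
  scaling _ _ (cs , refl) (ds , refl) =
    trans (cong (λ t → + suc p * t) (cong₂ (form T) (f-lincomb cs) (f-lincomb ds))) (embed-form cs ds)

-- Orthogonal frames and A₂⁴

Frame : Vec 𝓔⁴ 4 → Set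
Frame M = DualBases M (map conj⁴ M)

herm-lincomb : ∀ {M} → Frame M → ∀ cs → map (herm (lincomb cs M)) M ≡ three ·ᵥ cs
herm-lincomb {M} frame cs = trans (map-∘ (pair (lincomb cs M)) (map conj) M) (pair-dual frame cs)

form-lincomb : ∀ {M} → Frame M → ∀ cs ds → form𝓔⁴ (lincomb cs M) (lincomb ds M) ≡ + 3 * form𝓔⁴ cs ds
form-lincomb {M} frame cs ds = begin
  form𝓔⁴ u w                                ≡⟨ form-trace u w ⟩
  tr (pair u (map conj w))                  ≡⟨ cong tr (pair-lincombˡ cs M (map conj w)) ⟩
  tr (pair cs (map (λ g → herm g w) M))
    ≡⟨ cong (tr ∘ pair cs) (trans (map-cong (λ g → herm-sym g w) M) (map-∘ conj (herm w) M)) ⟩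
  tr (pair cs (map conj (map (herm w) M)))  ≡⟨ cong (λ v → tr (pair cs (map conj v))) (herm-lincomb frame ds) ⟩
  tr (pair cs (map conj (three ·ᵥ ds)))     ≡⟨ cong (tr ∘ pair cs) (conj-·ᵥ three ds) ⟩
  tr (pair cs (three ·ᵥ map conj ds))       ≡⟨ cong tr (pair-·ʳ three cs (map conj ds)) ⟩
  tr (three ⊗ herm cs ds)                   ≡⟨ tr-three (herm cs ds) ⟩
  + 3 * tr (herm cs ds)                     ≡⟨ cong (λ s → + 3 * s) (sym (form-trace cs ds)) ⟩
  + 3 * form𝓔⁴ cs ds                        ∎
  where
  u = lincomb cs M
  w = lincomb ds M

ψ : Vec ℤ 3 → 𝓔
ψ (p ∷ _ ∷ r ∷ []) = mkE p (- r)

φ-⊕ : ∀ x y → φ (x ⊕ y) ≡ zipWith _+_ (φ x) (φ y)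
φ-⊕ x y = byNormalisationᶻᵥ (Sym.φ (𝕩 ⊕ˣ 𝕪)) (zipWith _+ᶻ_ (Sym.φ 𝕩) (Sym.φ 𝕪)) refl (env (x ∷ y ∷ []))

φ-sum : ∀ x → sum (φ x) ≡ 0ℤ
φ-sum x = byNormalisationᶻ (Sym.sum (Sym.φ 𝕩)) (conᶻ 0ℤ) refl (env (x ∷ []))

dot-φ : ∀ x y → dot (φ x) (φ y) ≡ re2 x y
dot-φ x y = byNormalisationᶻ (Sym.dot (Sym.φ 𝕩) (Sym.φ 𝕪)) (Sym.re2 𝕩 𝕪) refl (env (x ∷ y ∷ []))

ψ-φ : ∀ x → ψ (φ x) ≡ x
ψ-φ x = cong (mkE (re x)) (ℤ.neg-involutive (om x))

φ-ψ : ∀ t → sum t ≡ 0ℤ → φ (ψ t) ≡ t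
φ-ψ (p ∷ q ∷ r ∷ []) Σ≡0 = cong₂ (λ s t → p ∷ s ∷ t ∷ []) middle (ℤ.neg-involutive r)
  where
  middle : - r - p ≡ q
  middle = begin
    - r - p
      ≡⟨ solve 3 (λ p q r → :- r :- p := q :- (p :+ (q :+ (r :+ con 0ℤ)))) refl p q r ⟩
    q - (p + (q + (r + 0ℤ)))  ≡⟨ cong (λ s → q - s) Σ≡0 ⟩
    q - 0ℤ                    ≡⟨ ℤ.+-identityʳ q ⟩
    q                         ∎

A2⁴-form : ∀ {n} (cs ds : Vec 𝓔 n) → sum (zipWith dot (map φ cs) (map φ ds)) ≡ formⁿ cs ds
A2⁴-form []       []       = refl
A2⁴-form (c ∷ cs) (d ∷ ds) = cong₂ _+_ (dot-φ c d) (A2⁴-form cs ds)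

frame-A2⁴-model : ∀ {M} → Frame M → CoordinateModel M A2⁴-space A2⁴
frame-A2⁴-model {M} frame = record
  { embed         = map φ
  ; unembed       = map ψ
  ; unembed-embed = λ cs → trans (sym (map-∘ ψ φ cs)) (trans (map-cong ψ-φ cs) (map-id cs))
  ; embed-⊕       = map-φ-⊕
  ; embed-into    = λ cs → map⁺ (universal φ-sum cs)
  ; embed-onto    = λ y sums → map ψ y , map-φ-ψ y sums
  ; p             = 2
  ; q             = 0
  ; embed-form    = λ cs ds → begin
      + 3 * sum (zipWith dot (map φ cs) (map φ ds))  ≡⟨ cong (λ s → + 3 * s) (A2⁴-form cs ds) ⟩
      + 3 * form𝓔⁴ cs ds                             ≡⟨ sym (form-lincomb frame cs ds) ⟩
      form𝓔⁴ (lincomb cs M) (lincomb ds M)           ≡⟨ sym (ℤ.*-identityˡ _) ⟩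
      + 1 * form𝓔⁴ (lincomb cs M) (lincomb ds M)     ∎
  }
  where
  map-φ-⊕ : ∀ {n} (cs ds : Vec 𝓔 n) → map φ (cs ⊕ᵥ ds) ≡ zipWith (zipWith _+_) (map φ cs) (map φ ds)
  map-φ-⊕ []       []       = refl
  map-φ-⊕ (c ∷ cs) (d ∷ ds) = cong₂ _∷_ (φ-⊕ c d) (map-φ-⊕ cs ds)
  map-φ-ψ : ∀ {n} (y : Vec (Vec ℤ 3) n) → All (λ t → sum t ≡ 0ℤ) y → map φ (map ψ y) ≡ y
  map-φ-ψ []       []         = refl
  map-φ-ψ (t ∷ ts) (s ∷ sums) = cong₂ _∷_ (φ-ψ t s) (map-φ-ψ ts sums)

Λ-generators : Vec (Vec 𝓔⁴ 4) 10
Λ-generators =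
  gens (# 0) ∷ gens (# 1) ∷ gens (# 2) ∷ gens (# 3) ∷ gens (# 4) ∷ gens (# 5) ∷
  map conj⁴ (gens (# 2)) ∷ map conj⁴ (gens (# 3)) ∷ map conj⁴ (gens (# 4)) ∷ map conj⁴ (gens (# 5)) ∷ []

Λ-span : ∀ i → Λ i ≡ InSpan (lookup Λ-generators i)
Λ-span zero                                                      = refl
Λ-span (suc zero)                                                = refl
Λ-span (suc (suc zero))                                          = refl
Λ-span (suc (suc (suc zero)))                                    = refl
Λ-span (suc (suc (suc (suc zero))))                              = refl
Λ-span (suc (suc (suc (suc (suc zero)))))                        = refl
Λ-span (suc (suc (suc (suc (suc (suc zero))))))                  = refl
Λ-span (suc (suc (suc (suc (suc (suc (suc zero)))))))            = refl
Λ-span (suc (suc (suc (suc (suc (suc (suc (suc zero))))))))      = refl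
Λ-span (suc (suc (suc (suc (suc (suc (suc (suc (suc zero))))))))) = refl

Λ-frames : All Frame Λ-generators
Λ-frames = refl ∷ refl ∷ refl ∷ refl ∷ refl ∷ refl ∷ refl ∷ refl ∷ refl ∷ refl ∷ []

frame-coordinates : Vec 𝓔⁴ 4 → 𝓔⁴ → Vec 𝓔 4
frame-coordinates M = coordinates (map conj⁴ M)

E8gens-in-Λ : All (λ M → Reconstructs M (frame-coordinates M) E8gens) Λ-generators
E8gens-in-Λ = refl ∷ refl ∷ refl ∷ refl ∷ refl ∷ refl ∷ refl ∷ refl ∷ refl ∷ refl ∷ []

Λ-similar : ∀ i → Similar 𝓔⁴-space (Λ i) A2⁴-space A2⁴
Λ-similar i = subst (λ L → Similar 𝓔⁴-space L A2⁴-space A2⁴) (sym (Λ-span i))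
  (span-similar (map conj⁴ (lookup Λ-generators i)) frame (frame-A2⁴-model frame))
  where frame = lookup⁺ Λ-frames i

Λ∩⊆Λ : ∀ i {v} → Λ∩ v → Λ i v
Λ∩⊆Λ i {v} v∈Λ∩ = subst (λ L → L v) (sym (Λ-span i))
  (span-⊆ (frame-coordinates (lookup Λ-generators i)) (lookup⁺ E8gens-in-Λ i) v∈Λ∩)

intersection-coefficients-spec : ∀ cs ds →
  lincomb (intersection-coefficients cs ds) E8gens
    ≡ lincomb ds (gens (# 0)) ⊕ᵥ defect (lincomb cs (gens (# 1)) ⊖ᵥ lincomb ds (gens (# 0)))
intersection-coefficients-spec cs@(_ ∷ _ ∷ _ ∷ _ ∷ []) ds@(_ ∷ _ ∷ _ ∷ _ ∷ []) =
  byNormalisationˣᵥ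
    (Sym.lincomb (Sym.intersection-coefficients x y) (liftᵐ E8gens))
    (Sym.lincomb y (liftᵐ (gens (# 0))) Sym.⊕ᵥ
       Sym.defect (Sym.lincomb x (liftᵐ (gens (# 1))) Sym.⊖ᵥ Sym.lincomb y (liftᵐ (gens (# 0)))))
    refl (env (cs ++ ds))
  where
  x = take 4 (variablesˣ 8)
  y = drop 4 (variablesˣ 8)

defect-diagonal : ∀ v → v ⊕ᵥ defect (v ⊖ᵥ v) ≡ v
defect-diagonal v@(_ ∷ _ ∷ _ ∷ _ ∷ []) =
  byNormalisationˣᵥ (x Sym.⊕ᵥ Sym.defect (x Sym.⊖ᵥ x)) x refl (env v)
  where x = variablesˣ 4

Λ₁∩Λ₂⊆Λ∩ : ∀ {v} → Λ zero v → Λ (suc zero) v → Λ∩ v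
Λ₁∩Λ₂⊆Λ∩ (ds , refl) (cs , v≡) = intersection-coefficients cs ds , (begin
  v                                             ≡⟨ sym (defect-diagonal v) ⟩
  v ⊕ᵥ defect (v ⊖ᵥ v)                          ≡⟨ cong (λ u → v ⊕ᵥ defect (u ⊖ᵥ v)) v≡ ⟩
  v ⊕ᵥ defect (lincomb cs (gens (# 1)) ⊖ᵥ v)    ≡⟨ sym (intersection-coefficients-spec cs ds) ⟩
  lincomb (intersection-coefficients cs ds) E8gens ∎)
  where v = lincomb ds (gens (# 0))

-- Λ∩ and E₈

E8duals : Vec 𝓔⁴ 4
E8duals = v4 m1 e0 e1 e1 ∷ v4 e0 m1 e1 (e1 ⊕ e1) ∷ v4 e0 e0 (⊖ θ) (⊖ θ) ∷ v4 e0 e0 e0 (⊖ θ) ∷ []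

E8-dual : DualBases E8gens E8duals
E8-dual = refl

parity : ∀ b → ∃[ m ] (b ≡ + 2 * m ⊎ b ≡ + 2 * m + 1ℤ)
parity b with b ℤ.%ℕ 2 | ℤ.a≡a%ℕn+[a/ℕn]*n b 2 | ℤ.n%ℕd<d b 2
... | 0           | b≡ | _ = b ℤ./ℕ 2 , inj₁ (trans b≡ (even (b ℤ./ℕ 2)))
  where even = solve 1 (λ m → con (+ 0) :+ m :* con (+ 2) := con (+ 2) :* m) refl
... | 1           | b≡ | _ = b ℤ./ℕ 2 , inj₂ (trans b≡ (odd (b ℤ./ℕ 2)))
  where odd = solve 1 (λ m → con (+ 1) :+ m :* con (+ 2) := con (+ 2) :* m :+ con 1ℤ) refl
... | suc (suc _) | _  | s≤s (s≤s ())

sum-shift : ∀ b (x : Vec ℤ 8) → sum (map (λ t → b + + 2 * t) x) ≡ + 8 * b + + 2 * sum x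
sum-shift b x@(_ ∷ _ ∷ _ ∷ _ ∷ _ ∷ _ ∷ _ ∷ _ ∷ []) =
  byNormalisationᶻ (Sym.sum (map (λ t → b̂ +ᶻ conᶻ (+ 2) *ᶻ t) x̂))
                   (conᶻ (+ 8) *ᶻ b̂ +ᶻ conᶻ (+ 2) *ᶻ Sym.sum x̂) refl (b ∷ x)
  where
  b̂ = lookup (variablesᶻ 9) zero
  x̂ = drop 1 (variablesᶻ 9)

two-divides : ∀ {t} m → t ≡ m * + 2 → + 2 ℤᵘ.∣ t
two-divides m eq = ℤˢ.∣⇒∣ᵤ (ℤˢ.divides m eq)

shift-parity : ∀ {n} b (x : Vec ℤ n) →
  All (λ t → + 2 ℤᵘ.∣ t) (map (λ t → b + + 2 * t) x) ⊎
  All (λ t → + 2 ℤᵘ.∣ (t + 1ℤ)) (map (λ t → b + + 2 * t) x)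
shift-parity b x with parity b
... | m , inj₁ refl = inj₁ (map⁺ (universal (λ t → two-divides (m + t) (even m t)) x))
  where even = solve 2 (λ m t → con (+ 2) :* m :+ con (+ 2) :* t := (m :+ t) :* con (+ 2)) refl
... | m , inj₂ refl = inj₂ (map⁺ (universal (λ t → two-divides (m + t + 1ℤ) (odd m t)) x))
  where odd = solve 2 (λ m t → con (+ 2) :* m :+ con 1ℤ :+ con (+ 2) :* t :+ con 1ℤ
                              := (m :+ t :+ con 1ℤ) :* con (+ 2)) refl

E8-shift : ∀ b (x : Vec ℤ 8) s → sum x ≡ + 2 * s → E8 (map (λ t → b + + 2 * t) x)
E8-shift b x s Σx≡ = shift-parity b x , ℤˢ.∣⇒∣ᵤ (ℤˢ.divides (+ 2 * b + s) (begin
  sum (map (λ t → b + + 2 * t) x)  ≡⟨ sum-shift b x ⟩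
  + 8 * b + + 2 * sum x            ≡⟨ cong (λ σ → + 8 * b + + 2 * σ) Σx≡ ⟩
  + 8 * b + + 2 * (+ 2 * s)        ≡⟨ solve 2 (λ b s → con (+ 8) :* b :+ con (+ 2) :* (con (+ 2) :* s)
                                                      := (con (+ 2) :* b :+ s) :* con (+ 4)) refl b s ⟩
  (+ 2 * b + s) * + 4              ∎))

sum-E8-half : ∀ e₁ e₂ e₃ e₄ → sum (E8-half (e₁ ∷ e₂ ∷ e₃ ∷ e₄ ∷ [])) ≡ + 2 * (re e₁ + re e₂ - re e₃)
sum-E8-half e₁ e₂ e₃ e₄ =
  byNormalisationᶻ (Sym.sum (Sym.E8-half (𝕩 ∷ 𝕪 ∷ 𝕫 ∷ 𝕨 ∷ [])))
                   (conᶻ (+ 2) *ᶻ (proj₁ 𝕩 +ᶻ proj₁ 𝕪 -ᶻ proj₁ 𝕫)) refl (env (e₁ ∷ e₂ ∷ e₃ ∷ e₄ ∷ []))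

E8-congruent : ∀ {y} → E8 y → All (λ t → + 2 ℤˢ.∣ (t - last y)) y
E8-congruent {_ ∷ _ ∷ _ ∷ _ ∷ _ ∷ _ ∷ _ ∷ y₈ ∷ []} (inj₁ evens@(_ ∷ _ ∷ _ ∷ _ ∷ _ ∷ _ ∷ _ ∷ d₈ ∷ []) , _) =
  All.map (λ {t} d → ℤˢ.∣m∣n⇒∣m-n {m = t} {n = y₈} (ℤˢ.∣ᵤ⇒∣ d) (ℤˢ.∣ᵤ⇒∣ d₈)) evens
E8-congruent {_ ∷ _ ∷ _ ∷ _ ∷ _ ∷ _ ∷ _ ∷ y₈ ∷ []} (inj₂ odds@(_ ∷ _ ∷ _ ∷ _ ∷ _ ∷ _ ∷ _ ∷ d₈ ∷ []) , _) =
  All.map (λ {t} d → subst (+ 2 ℤˢ.∣_) (cancel t)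
                         (ℤˢ.∣m∣n⇒∣m-n {m = t + 1ℤ} {n = y₈ + 1ℤ} (ℤˢ.∣ᵤ⇒∣ d) (ℤˢ.∣ᵤ⇒∣ d₈))) odds
  where
  cancel : ∀ t → t + 1ℤ - (y₈ + 1ℤ) ≡ t - y₈
  cancel t = solve 2 (λ t y → t :+ con 1ℤ :- (y :+ con 1ℤ) := t :- y) refl t y₈

shifted : ∀ {t b} → + 2 ℤˢ.∣ (t - b) → ∃[ q ] t ≡ b + + 2 * q
shifted {t} {b} (ℤˢ.divides q t-b≡) = q , (begin
  t            ≡⟨ solve 2 (λ t b → t := b :+ (t :- b)) refl t b ⟩
  b + (t - b)  ≡⟨ cong (λ s → b + s) t-b≡ ⟩
  b + q * + 2  ≡⟨ cong (λ s → b + s) (ℤ.*-comm q (+ 2)) ⟩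
  b + + 2 * q  ∎)

solve-fifth : ∀ b q₁ q₂ q₃ q₄ q₅ q₆ q₇ Q →
  sum (E8-shifted b (q₁ ∷ q₂ ∷ q₃ ∷ q₄ ∷ q₅ ∷ q₆ ∷ q₇ ∷ [])) ≡ Q * + 4 →
  q₅ ≡ fifth b (q₁ ∷ q₂ ∷ q₃ ∷ q₄ ∷ q₆ ∷ q₇ ∷ Q ∷ [])
solve-fifth b q₁ q₂ q₃ q₄ q₅ q₆ q₇ Q Σ≡ = ℤ.*-cancelˡ-≡ (+ 2) q₅ q₅′ (begin
  + 2 * q₅                         ≡⟨ linear ⟩
  + 2 * q₅′ + (σ - Q * + 4)        ≡⟨ cong (λ s → + 2 * q₅′ + (s - Q * + 4)) Σ≡ ⟩
  + 2 * q₅′ + (Q * + 4 - Q * + 4)  ≡⟨ cong (λ s → + 2 * q₅′ + s) (ℤ.+-inverseʳ (Q * + 4)) ⟩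
  + 2 * q₅′ + 0ℤ                   ≡⟨ ℤ.+-identityʳ _ ⟩
  + 2 * q₅′                        ∎)
  where
  q₅′ = fifth b (q₁ ∷ q₂ ∷ q₃ ∷ q₄ ∷ q₆ ∷ q₇ ∷ Q ∷ [])
  σ = sum (E8-shifted b (q₁ ∷ q₂ ∷ q₃ ∷ q₄ ∷ q₅ ∷ q₆ ∷ q₇ ∷ []))
  linear : + 2 * q₅ ≡ + 2 * q₅′ + (σ - Q * + 4)
  linear = byNormalisationᶻ (conᶻ (+ 2) *ᶻ v (# 5))
    (conᶻ (+ 2) *ᶻ Sym.fifth (v (# 0)) (map v (# 1 ∷ # 2 ∷ # 3 ∷ # 4 ∷ # 6 ∷ # 7 ∷ # 8 ∷ [])) +ᶻ
     (Sym.sum (Sym.E8-shifted (v (# 0)) (map v (# 1 ∷ # 2 ∷ # 3 ∷ # 4 ∷ # 5 ∷ # 6 ∷ # 7 ∷ [])))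
      -ᶻ v (# 8) *ᶻ conᶻ (+ 4)))
    refl (b ∷ q₁ ∷ q₂ ∷ q₃ ∷ q₄ ∷ q₅ ∷ q₆ ∷ q₇ ∷ Q ∷ [])
    where v = lookup (variablesᶻ 9)

E8-sum : ∀ {y} → E8 y → + 4 ℤˢ.∣ sum y
E8-sum {y} (_ , 4∣Σ) = ℤˢ.∣ᵤ⇒∣ {+ 4} {sum y} 4∣Σ

E8-parametrised : ∀ {y} → E8 y → ∃[ ps ] E8-param (last y) ps ≡ y
E8-parametrised {y₁ ∷ y₂ ∷ y₃ ∷ y₄ ∷ y₅ ∷ y₆ ∷ y₇ ∷ b ∷ []} e8
  with E8-congruent e8 | E8-sum e8
... | c₁ ∷ c₂ ∷ c₃ ∷ c₄ ∷ c₅ ∷ c₆ ∷ c₇ ∷ _ ∷ [] | ℤˢ.divides Q Σ≡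
  with shifted {y₁} {b} c₁ | shifted {y₂} {b} c₂ | shifted {y₃} {b} c₃ | shifted {y₄} {b} c₄
     | shifted {y₅} {b} c₅ | shifted {y₆} {b} c₆ | shifted {y₇} {b} c₇
... | q₁ , refl | q₂ , refl | q₃ , refl | q₄ , refl | q₅ , refl | q₆ , refl | q₇ , refl
  with solve-fifth b q₁ q₂ q₃ q₄ q₅ q₆ q₇ Q Σ≡
... | refl = q₁ ∷ q₂ ∷ q₃ ∷ q₄ ∷ q₆ ∷ q₇ ∷ Q ∷ [] , refl

toE8-preimage : ∀ b ps → toE8 (E8-preimage b ps) ≡ E8-param b ps
toE8-preimage b ps@(_ ∷ _ ∷ _ ∷ _ ∷ _ ∷ _ ∷ _ ∷ []) =
  byNormalisationᶻᵥ (Sym.toE8 (Sym.E8-preimage b̂ p̂s)) (Sym.E8-param b̂ p̂s) refl (b ∷ ps)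
  where
  b̂ = lookup (variablesᶻ 8) zero
  p̂s = drop 1 (variablesᶻ 8)

E8-onto : ∀ y → E8 y → ∃[ es ] toE8 es ≡ y
E8-onto y e8 with E8-parametrised e8
... | ps , param≡y = E8-preimage (last y) ps , trans (toE8-preimage (last y) ps) param≡y

quadrupled-coordinates-toE8 : ∀ es → quadrupled-coordinates (toE8 es) ≡ map (scale (+ 4)) es
quadrupled-coordinates-toE8 es@(_ ∷ _ ∷ _ ∷ _ ∷ []) =
  byNormalisationˣᵥ (Sym.quadrupled-coordinates (Sym.toE8 x)) (map (Sym.scale (+ 4)) x) refl (env es)
  where x = variablesˣ 4

toE8-⊕ : ∀ es ds → toE8 (es ⊕ᵥ ds) ≡ zipWith _+_ (toE8 es) (toE8 ds)
toE8-⊕ es@(_ ∷ _ ∷ _ ∷ _ ∷ []) ds@(_ ∷ _ ∷ _ ∷ _ ∷ []) =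
  byNormalisationᶻᵥ (Sym.toE8 (x Sym.⊕ᵥ y)) (zipWith _+ᶻ_ (Sym.toE8 x) (Sym.toE8 y)) refl (env (es ++ ds))
  where
  x = take 4 (variablesˣ 8)
  y = drop 4 (variablesˣ 8)

toE8-form : ∀ es ds → + 9 * dot (toE8 es) (toE8 ds) ≡ + 4 * form𝓔⁴ (lincomb es E8gens) (lincomb ds E8gens)
toE8-form es@(_ ∷ _ ∷ _ ∷ _ ∷ []) ds@(_ ∷ _ ∷ _ ∷ _ ∷ []) =
  byNormalisationᶻ (conᶻ (+ 9) *ᶻ Sym.dot (Sym.toE8 x) (Sym.toE8 y))
    (conᶻ (+ 4) *ᶻ Sym.formⁿ (Sym.lincomb x (liftᵐ E8gens)) (Sym.lincomb y (liftᵐ E8gens)))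
    refl (env (es ++ ds))
  where
  x = take 4 (variablesˣ 8)
  y = drop 4 (variablesˣ 8)

E8-model : CoordinateModel E8gens ℤ⁸-space E8
E8-model = record
  { embed         = toE8
  ; unembed       = map (divide 4) ∘ quadrupled-coordinates
  ; unembed-embed = λ es → begin
      map (divide 4) (quadrupled-coordinates (toE8 es))
        ≡⟨ cong (map (divide 4)) (quadrupled-coordinates-toE8 es) ⟩
      map (divide 4) (map (scale (+ 4)) es)             ≡⟨ sym (map-∘ (divide 4) (scale (+ 4)) es) ⟩
      map (divide 4 ∘ scale (+ 4)) es                   ≡⟨ map-cong (divide-scale 3) es ⟩
      map id es                                         ≡⟨ map-id es ⟩
      es                                                ∎
  ; embed-⊕       = toE8-⊕
  ; embed-into    = λ { es@(e₁ ∷ e₂ ∷ e₃ ∷ e₄ ∷ []) →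
      E8-shift (om e₃) (E8-half es) (re e₁ + re e₂ - re e₃) (sum-E8-half e₁ e₂ e₃ e₄) }
  ; embed-onto    = E8-onto
  ; p             = 8
  ; q             = 3
  ; embed-form    = toE8-form
  }

Λ∩-similar : Similar 𝓔⁴-space Λ∩ ℤ⁸-space E8
Λ∩-similar = span-similar E8duals E8-dual E8-model

mainTheorem5 : ((i : Fin 10) → Similar 𝓔⁴-space (Λ i) A2⁴-space A2⁴) ×
    ((v : 𝓔⁴) → (((i : Fin 10) → Λ i v) ⇔ Λ∩ v)) ×
    Similar 𝓔⁴-space Λ∩ ℤ⁸-space E8 ×
    ((v : 𝓔⁴) → ((Λ zero v × Λ (suc zero) v) ⇔ Λ∩ v))
mainTheorem5 =
  Λ-similar ,
  (λ v → mk⇔ (λ v∈Λ → Λ₁∩Λ₂⊆Λ∩ (v∈Λ zero) (v∈Λ (suc zero))) (λ v∈Λ∩ i → Λ∩⊆Λ i v∈Λ∩)) ,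
  Λ∩-similar ,
  (λ v → mk⇔ (λ (v∈Λ₁ , v∈Λ₂) → Λ₁∩Λ₂⊆Λ∩ v∈Λ₁ v∈Λ₂) (λ v∈Λ∩ → Λ∩⊆Λ zero v∈Λ∩ , Λ∩⊆Λ (suc zero) v∈Λ∩))
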